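{- Let $A,B\in\mathbb Z^{d\times d}$ be nonsingular and let $\sigma_1,\sigma_2\in\mathfrak S_d$ be such that $\phi(A\cdot\sigma_1)=\phi(B\cdot\sigma_2)=(h_1,\dots,h_d)$ with $$h_1=\cdots=h_{m_1}<h_{m_1+1}=\cdots=h_{m_1+m_2}<\cdots<h_{m_1+\cdots+m_{s-1}+1}=\cdots=h_{m_1+\cdots+m_s}=h_d.$$ Let $\mathcal S_{\mathrm{GCD}}=\sigma_2\,\mathfrak S_{(m_1,\dots,m_s)}\,\sigma_1^{ -1}$. Then $A\simeq_{\mathrm{UP}}B$ if and only if $A\simeq_{\mathcal S_{\mathrm{GCD}}}B$.
   Context: For $\sigma\in\mathfrak S_d$, $M\cdot\sigma=M(\mathbf e_{\sigma(1)}|\cdots|\mathbf e_{\sigma(d)})$. For a subset $\mathcal I\subseteq\mathfrak S_d$, $A\simeq_{\mathcal I}B$ means $UA=B\cdot g$ for some $U\in\mathrm{GL}_d(\mathbb Z)$ and $g\in\mathcal I$; $\simeq_{\mathrm{UP}}$ is $\simeq_{\mathfrak S_d}$. For $A=(\alpha_1|\cdots|\alpha_d)$, $\phi(A)=(\gcd(\alpha_1),\dots,\gcd(\alpha_d))$ (gcd of the entries of each column). $\mathfrak S_{(m_1,\dots,m_s)}$ is the Young subgroup $\mathfrak S_{w_1}\times\cdots\times\mathfrak S_{w_s}$ with $w_i=\{m_1+\dots+m_{i-1}+1,\dots,m_1+\dots+m_i\}$. -}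

module Defs where

open import Data.Nat as ℕ using (ℕ; zero; suc; _≤_; _<_)
open import Data.Nat.GCD using (gcd)
open import Data.Integer as ℤ using (ℤ; +_; ∣_∣)
open import Data.Fin using (Fin; zero; suc; toℕ; punchIn)
open import Data.Fin.Permutation using (Permutation′; _⟨$⟩ʳ_; _⟨$⟩ˡ_)
open import Data.Product using (Σ; _×_; ∃)
open import Relation.Binary.PropositionalEquality using (_≡_)
open import Relation.Nullary using (¬_; yes; no)
open import Data.Unit using (⊤)
open import Data.Fin using (_≟_)

-- d×d integer matrices: M i j = entry in row i, column j (0-indexed).
Mat : ℕ → Set
Mat d = Fin d → Fin d → ℤ

sumℤ : ∀ {n} → (Fin n → ℤ) → ℤ
sumℤ {zero}  f = + 0
sumℤ {suc n} f = f zero ℤ.+ sumℤ (λ k → f (suc k))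

sumℕ : ∀ {n} → (Fin n → ℕ) → ℕ
sumℕ {zero}  f = 0
sumℕ {suc n} f = f zero ℕ.+ sumℕ (λ k → f (suc k))

infixl 7 _⊗_
infixl 7 _·_
infix 4 _≐_

_⊗_ : ∀ {d} → Mat d → Mat d → Mat d
(M ⊗ N) i j = sumℤ (λ k → M i k ℤ.* N k j)

I : ∀ {d} → Mat d
I i j with i ≟ j
... | yes _ = + 1
... | no  _ = + 0

_≐_ : ∀ {d} → Mat d → Mat d → Set
M ≐ N = ∀ i j → M i j ≡ N i j

GL : ∀ {d} → Mat d → Set
GL {d} U = Σ (Mat d) λ V → (U ⊗ V ≐ I) × (V ⊗ U ≐ I)

det : ∀ {d} → Mat d → ℤ
det {zero}  M = + 1
det {suc d} M = sumℤ (λ j → sign j ℤ.* (M zero j ℤ.* det (λ i k → M (suc i) (punchIn j k))))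
  where
  sign : Fin (suc d) → ℤ
  sign j with toℕ j ℕ.% 2
  ... | zero = + 1
  ... | suc _ = ℤ.- (+ 1)

Nonsingular : ∀ {d} → Mat d → Set
Nonsingular M = ¬ (det M ≡ + 0)

-- M·σ = M (e_{σ(1)} | ... | e_{σ(d)}): column j of M·σ is column σ(j) of M
_·_ : ∀ {d} → Mat d → Permutation′ d → Mat d
(M · σ) i j = M i (σ ⟨$⟩ʳ j)

-- gcd of the entries of a column (gcd over an empty family is 0)
gcdFin : ∀ {n} → (Fin n → ℕ) → ℕ
gcdFin {zero}  f = 0
gcdFin {suc n} f = gcd (f zero) (gcdFin (λ k → f (suc k)))

φ : ∀ {d} → Mat d → Fin d → ℕ
φ A j = gcdFin (λ i → ∣ A i j ∣)

-- A ≃_P B  for a predicate P on permutations (a subset of S_d)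
Equiv : ∀ {d} → (Permutation′ d → Set) → Mat d → Mat d → Set
Equiv {d} P A B = Σ (Mat d) λ U → GL U × Σ (Permutation′ d) λ g → P g × ((U ⊗ A) ≐ (B · g))

EquivUP : ∀ {d} → Mat d → Mat d → Set
EquivUP A B = Equiv (λ _ → ⊤) A B

-- Compositions (m_1,...,m_s) of d, blocks w_i (0-indexed):
-- before m i = m_1 + ... + m_{i-1}
before : ∀ {s} → (Fin s → ℕ) → Fin s → ℕ
before m zero    = 0
before m (suc i) = m zero ℕ.+ before (λ k → m (suc k)) i

InBlock : ∀ {s d} → (Fin s → ℕ) → Fin s → Fin d → Set
InBlock m i j = before m i ≤ toℕ j × toℕ j < before m i ℕ.+ m i

-- τ ∈ S_{(m_1,...,m_s)} = S_{w_1} × ... × S_{w_s}: τ maps each block w_i into itself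
Young : ∀ {s d} → (Fin s → ℕ) → Permutation′ d → Set
Young {s} m τ = ∀ (i : Fin s) j → InBlock m i j → InBlock m i (τ ⟨$⟩ʳ j)

InSGCD : ∀ {s d} → (Fin s → ℕ) → Permutation′ d → Permutation′ d → Permutation′ d → Set
InSGCD m σ1 σ2 g = ∃ λ τ → Young m τ × (∀ j → g ⟨$⟩ʳ j ≡ σ2 ⟨$⟩ʳ (τ ⟨$⟩ʳ (σ1 ⟨$⟩ˡ j)))

Composition : ∀ {s} → ℕ → (Fin s → ℕ) → Set
Composition {s} d m = (∀ i → 1 ≤ m i) × sumℕ m ≡ d

BlockProfile : ∀ {s d} → (Fin s → ℕ) → (Fin d → ℕ) → Set
BlockProfile {s} {d} m h =
  (∀ (i : Fin s) (j k : Fin d) → InBlock m i j → InBlock m i k → h j ≡ h k) ×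
  (∀ (i i′ : Fin s) (j k : Fin d) → toℕ i < toℕ i′ → InBlock m i j → InBlock m i′ k → h j < h k)

{-# OPTIONS --safe #-}
module Submission where

-- Left multiplication by U ∈ GL_d(ℤ) preserves the gcd of every column: the entries
-- of column j of U A are integer combinations of those of column j of A, and
-- conversely via U⁻¹. Hence
-- U A = B g gives φ(A)_j = φ(B)_{g(j)}, so τ = σ₂⁻¹ g σ₁ fixes the profile h.
-- As h is constant on each block and strictly increasing across blocks, a map
-- fixing h maps each block into itself: τ is in the Young subgroup and
-- g = σ₂ τ σ₁⁻¹ ∈ S_GCD.

open import Defs
open import Data.Nat using (ℕ)
open import Data.Fin using (Fin)
open import Data.Fin.Permutation using (Permutation′)
open import Data.Product using (_×_)
open import Function.Bundles using (_⇔_)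
open import Relation.Binary.PropositionalEquality using (_≡_)

open import Data.Nat as ℕ using (zero; suc; z≤n)
open import Data.Nat.Properties
  using (≮⇒≥; m≤n⇒∃[o]m+o≡n; +-cancelˡ-<; +-monoʳ-≤; +-monoʳ-<; +-assoc; <-cmp; <-irrefl)
open import Data.Nat.Divisibility as ℕ using (_∣0; ∣-trans; ∣-antisym; ∣-reflexive)
open import Data.Nat.GCD using (gcd; gcd[m,n]∣m; gcd[m,n]∣n; gcd-greatest)
open import Data.Integer as ℤ using (ℤ; +_; ∣_∣)
open import Data.Integer.Properties using (+-*-semiring; *-assoc; *-zeroˡ; *-identityˡ; +-identityʳ)
open import Data.Integer.Divisibility.Signed as ℤ using (∣ᵤ⇒∣; ∣⇒∣ᵤ; ∣m∣n⇒∣m+n; ∣n⇒∣m*n)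
open import Data.Fin using (zero; suc; toℕ; punchIn; _≟_)
open import Data.Fin.Properties using (toℕ<n; toℕ-injective; punchInᵢ≢i)
open import Data.Fin.Permutation using (_⟨$⟩ʳ_; _⟨$⟩ˡ_; inverseʳ; flip; _∘ₚ_)
open import Data.Product using (∃; _,_)
open import Data.Unit using (tt)
open import Function using (_∘_)
open import Function.Bundles using (mk⇔)
open import Relation.Binary.Definitions using (tri<; tri≈; tri>)
open import Relation.Nullary using (yes; no; ¬_; contradiction)
open import Relation.Binary.PropositionalEquality
  using (refl; sym; trans; cong; cong₂; subst; module ≡-Reasoning)
open import Algebra.Properties.Semiring.Sum +-*-semiring
  using (sum; sum-cong-≗; ∑-comm; *-distribˡ-sum; *-distribʳ-sum; sum-remove; sum-replicate-zero)

private
  variable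
    d n s : ℕ

sumℤ≡sum : (f : Fin n → ℤ) → sumℤ f ≡ sum f
sumℤ≡sum {zero}  f = refl
sumℤ≡sum {suc n} f = cong (ℤ._+_ (f zero)) (sumℤ≡sum (f ∘ suc))

⊗-entry : (M N : Mat d) (i j : Fin d) → (M ⊗ N) i j ≡ sum (λ k → M i k ℤ.* N k j)
⊗-entry M N i j = sumℤ≡sum (λ k → M i k ℤ.* N k j)

⊗-assoc : (M N P : Mat d) → (M ⊗ N) ⊗ P ≐ M ⊗ (N ⊗ P)
⊗-assoc M N P i j = begin
  ((M ⊗ N) ⊗ P) i j
    ≡⟨ ⊗-entry (M ⊗ N) P i j ⟩
  sum (λ l → (M ⊗ N) i l ℤ.* P l j)
    ≡⟨ sum-cong-≗ (λ l → cong (ℤ._* P l j) (⊗-entry M N i l)) ⟩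
  sum (λ l → sum (λ k → M i k ℤ.* N k l) ℤ.* P l j)
    ≡⟨ sum-cong-≗ (λ l → *-distribʳ-sum (P l j) (λ k → M i k ℤ.* N k l)) ⟩
  sum (λ l → sum (λ k → M i k ℤ.* N k l ℤ.* P l j))
    ≡⟨ ∑-comm (λ l k → M i k ℤ.* N k l ℤ.* P l j) ⟩
  sum (λ k → sum (λ l → M i k ℤ.* N k l ℤ.* P l j))
    ≡⟨ sum-cong-≗ (λ k → sum-cong-≗ (λ l → *-assoc (M i k) (N k l) (P l j))) ⟩
  sum (λ k → sum (λ l → M i k ℤ.* (N k l ℤ.* P l j)))
    ≡⟨ sum-cong-≗ (λ k → sym (*-distribˡ-sum (M i k) (λ l → N k l ℤ.* P l j))) ⟩
  sum (λ k → M i k ℤ.* sum (λ l → N k l ℤ.* P l j))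
    ≡⟨ sum-cong-≗ (λ k → cong (M i k ℤ.*_) (sym (⊗-entry N P k j))) ⟩
  sum (λ k → M i k ℤ.* (N ⊗ P) k j)
    ≡⟨ sym (⊗-entry M (N ⊗ P) i j) ⟩
  (M ⊗ (N ⊗ P)) i j ∎
  where open ≡-Reasoning

I-diagonal : (k : Fin d) → I k k ≡ + 1
I-diagonal k with k ≟ k
... | yes _  = refl
... | no k≢k = contradiction refl k≢k

I-off-diagonal : {k l : Fin d} → ¬ k ≡ l → I k l ≡ + 0
I-off-diagonal {k = k} {l} k≢l with k ≟ l
... | yes k≡l = contradiction k≡l k≢l
... | no _    = refl

⊗-identityˡ : (M : Mat d) → I ⊗ M ≐ M
⊗-identityˡ {suc d} M k j = begin
  (I ⊗ M) k j
    ≡⟨ ⊗-entry I M k j ⟩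
  sum (λ l → I k l ℤ.* M l j)
    ≡⟨ sum-remove {i = k} (λ l → I k l ℤ.* M l j) ⟩
  I k k ℤ.* M k j ℤ.+ sum (λ l → I k (punchIn k l) ℤ.* M (punchIn k l) j)
    ≡⟨ cong₂ ℤ._+_ (trans (cong (ℤ._* M k j) (I-diagonal k)) (*-identityˡ (M k j)))
                   (trans (sum-cong-≗ off-diagonal) (sum-replicate-zero d)) ⟩
  M k j ℤ.+ + 0
    ≡⟨ +-identityʳ (M k j) ⟩
  M k j ∎
  where
  open ≡-Reasoning
  off-diagonal : ∀ l → I k (punchIn k l) ℤ.* M (punchIn k l) j ≡ + 0
  off-diagonal l = trans (cong (ℤ._* M (punchIn k l) j) (I-off-diagonal (punchInᵢ≢i k l ∘ sym)))
                         (*-zeroˡ (M (punchIn k l) j))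

⊗-congˡ : {M N : Mat d} (P : Mat d) → M ≐ N → M ⊗ P ≐ N ⊗ P
⊗-congˡ {M = M} {N} P M≐N i j = begin
  (M ⊗ P) i j                  ≡⟨ ⊗-entry M P i j ⟩
  sum (λ k → M i k ℤ.* P k j)  ≡⟨ sum-cong-≗ (λ k → cong (ℤ._* P k j) (M≐N i k)) ⟩
  sum (λ k → N i k ℤ.* P k j)  ≡⟨ sym (⊗-entry N P i j) ⟩
  (N ⊗ P) i j                  ∎
  where open ≡-Reasoning

⊗-cancelˡ : {U V : Mat d} (M : Mat d) → V ⊗ U ≐ I → V ⊗ (U ⊗ M) ≐ M
⊗-cancelˡ {U = U} {V} M VU≐I i j = begin
  (V ⊗ (U ⊗ M)) i j  ≡⟨ sym (⊗-assoc V U M i j) ⟩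
  ((V ⊗ U) ⊗ M) i j  ≡⟨ ⊗-congˡ M VU≐I i j ⟩
  (I ⊗ M) i j        ≡⟨ ⊗-identityˡ M i j ⟩
  M i j              ∎
  where open ≡-Reasoning

gcdFin∣ : (f : Fin n → ℕ) (k : Fin n) → gcdFin f ℕ.∣ f k
gcdFin∣ f zero    = gcd[m,n]∣m _ _
gcdFin∣ f (suc k) = ∣-trans (gcd[m,n]∣n (f zero) _) (gcdFin∣ (f ∘ suc) k)

gcdFin-greatest : (f : Fin n → ℕ) {c : ℕ} → (∀ k → c ℕ.∣ f k) → c ℕ.∣ gcdFin f
gcdFin-greatest {zero}  f c∣f = _ ∣0
gcdFin-greatest {suc n} f c∣f = gcd-greatest (c∣f zero) (gcdFin-greatest (f ∘ suc) (c∣f ∘ suc))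

gcdFin-cong : {f g : Fin n → ℕ} → (∀ k → f k ≡ g k) → gcdFin f ≡ gcdFin g
gcdFin-cong {zero}  f≡g = refl
gcdFin-cong {suc n} f≡g = cong₂ gcd (f≡g zero) (gcdFin-cong (f≡g ∘ suc))

∣-sumℤ-* : {c : ℤ} (w x : Fin n → ℤ) → (∀ k → c ℤ.∣ x k) → c ℤ.∣ sumℤ (λ k → w k ℤ.* x k)
∣-sumℤ-* {zero}  w x c∣x = ∣ᵤ⇒∣ (_ ∣0)
∣-sumℤ-* {suc n} w x c∣x =
  ∣m∣n⇒∣m+n (∣n⇒∣m*n (w zero) (c∣x zero)) (∣-sumℤ-* (w ∘ suc) (x ∘ suc) (c∣x ∘ suc))

φ-cong : {M N : Mat d} → M ≐ N → ∀ j → φ M j ≡ φ N j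
φ-cong M≐N j = gcdFin-cong (λ i → cong ∣_∣ (M≐N i j))

φ∣φ-⊗ : (U M : Mat d) (j : Fin d) → φ M j ℕ.∣ φ (U ⊗ M) j
φ∣φ-⊗ U M j = gcdFin-greatest (λ i → ∣ (U ⊗ M) i j ∣) λ i →
  ∣⇒∣ᵤ (∣-sumℤ-* {c = + φ M j} (U i) (λ l → M l j) (λ l → ∣ᵤ⇒∣ (gcdFin∣ (λ i → ∣ M i j ∣) l)))

φ-⊗-GL : {U : Mat d} → GL U → (M : Mat d) (j : Fin d) → φ (U ⊗ M) j ≡ φ M j
φ-⊗-GL {U = U} (V , _ , VU≐I) M j = ∣-antisym
  (∣-trans (φ∣φ-⊗ V (U ⊗ M) j) (∣-reflexive (φ-cong (⊗-cancelˡ {U = U} {V} M VU≐I) j)))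
  (φ∣φ-⊗ U M j)

φ-⊗≐· : ∀ {A B U : Mat d} {g : Permutation′ d} → GL U → U ⊗ A ≐ B · g →
      ∀ j → φ B (g ⟨$⟩ʳ j) ≡ φ A j
φ-⊗≐· {A = A} {B} {g = g} U∈GL UA≐Bg j = trans (sym (φ-cong {N = B · g} UA≐Bg j)) (φ-⊗-GL U∈GL A j)

∈-some-block : (m : Fin s → ℕ) (x : ℕ) → x ℕ.< sumℕ m →
               ∃ λ i → before m i ℕ.≤ x × x ℕ.< before m i ℕ.+ m i
∈-some-block {suc s} m x x<Σm with x ℕ.<? m zero
... | yes x<m₀ = zero , z≤n , x<m₀
... | no x≮m₀ with m≤n⇒∃[o]m+o≡n (≮⇒≥ x≮m₀)
... | y , refl with ∈-some-block (m ∘ suc) y (+-cancelˡ-< (m zero) _ _ x<Σm)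
... | i , b≤y , y<b+mᵢ =
  suc i , +-monoʳ-≤ (m zero) b≤y
        , subst (m zero ℕ.+ y ℕ.<_) (sym (+-assoc (m zero) _ _)) (+-monoʳ-< (m zero) y<b+mᵢ)

InBlock-total : {m : Fin s → ℕ} → sumℕ m ≡ d → (j : Fin d) → ∃ λ i → InBlock m i j
InBlock-total {m = m} Σm≡d j = ∈-some-block m (toℕ j) (subst (toℕ j ℕ.<_) (sym Σm≡d) (toℕ<n j))

InBlock-unique : {m : Fin s → ℕ} {h : Fin d → ℕ} → BlockProfile m h →
                 ∀ {i i′ j k} → InBlock m i j → InBlock m i′ k → h j ≡ h k → i ≡ i′
InBlock-unique (_ , increasing) {i} {i′} j∈wᵢ k∈wᵢ′ hj≡hk with <-cmp (toℕ i) (toℕ i′)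
... | tri< i<i′ _ _ = contradiction (increasing i i′ _ _ i<i′ j∈wᵢ k∈wᵢ′) (<-irrefl hj≡hk)
... | tri≈ _ i≡i′ _ = toℕ-injective i≡i′
... | tri> _ _ i′<i = contradiction (increasing i′ i _ _ i′<i k∈wᵢ′ j∈wᵢ) (<-irrefl (sym hj≡hk))

profile-preserving⇒Young : {m : Fin s → ℕ} {h : Fin d → ℕ} → sumℕ m ≡ d → BlockProfile m h →
                           (τ : Permutation′ d) → (∀ k → h (τ ⟨$⟩ʳ k) ≡ h k) → Young m τ
profile-preserving⇒Young {m = m} Σm≡d profile τ hτ≡h i j j∈wᵢ
  with InBlock-total {m = m} Σm≡d (τ ⟨$⟩ʳ j)
... | i′ , τj∈wᵢ′ =
  subst (λ t → InBlock m t (τ ⟨$⟩ʳ j)) (sym (InBlock-unique profile j∈wᵢ τj∈wᵢ′ (sym (hτ≡h j)))) τj∈wᵢ′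

lemma4p12 : (d : ℕ) (A B : Mat d) → Nonsingular A → Nonsingular B →
    (σ1 σ2 : Permutation′ d) (h : Fin d → ℕ) →
    (∀ j → φ (A · σ1) j ≡ h j) → (∀ j → φ (B · σ2) j ≡ h j) →
    (s : ℕ) (m : Fin s → ℕ) → Composition d m → BlockProfile m h →
    EquivUP A B ⇔ Equiv (InSGCD m σ1 σ2) A B
lemma4p12 d A B _ _ σ1 σ2 h φAσ1≡h φBσ2≡h s m (_ , Σm≡d) profile = mk⇔ to from
  where
  from : Equiv (InSGCD m σ1 σ2) A B → EquivUP A B
  from (U , U∈GL , g , _ , UA≐Bg) = U , U∈GL , g , tt , UA≐Bg

  to : EquivUP A B → Equiv (InSGCD m σ1 σ2) A B
  to (U , U∈GL , g , _ , UA≐Bg) = U , U∈GL , g , (τ , τ∈Young , g≡σ2τσ1⁻¹) , UA≐Bg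
    where
    τ : Permutation′ d
    τ = σ1 ∘ₚ g ∘ₚ flip σ2

    hτ≡h : ∀ k → h (τ ⟨$⟩ʳ k) ≡ h k
    hτ≡h k = begin
      h (τ ⟨$⟩ʳ k)                 ≡⟨ sym (φBσ2≡h (τ ⟨$⟩ʳ k)) ⟩
      φ B (σ2 ⟨$⟩ʳ (τ ⟨$⟩ʳ k))     ≡⟨ cong (φ B) (inverseʳ σ2) ⟩
      φ B (g ⟨$⟩ʳ (σ1 ⟨$⟩ʳ k))     ≡⟨ φ-⊗≐· {B = B} {g = g} U∈GL UA≐Bg (σ1 ⟨$⟩ʳ k) ⟩
      φ A (σ1 ⟨$⟩ʳ k)              ≡⟨ φAσ1≡h k ⟩
      h k                          ∎
      where open ≡-Reasoning

    τ∈Young : Young m τ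
    τ∈Young = profile-preserving⇒Young Σm≡d profile τ hτ≡h

    g≡σ2τσ1⁻¹ : ∀ j → g ⟨$⟩ʳ j ≡ σ2 ⟨$⟩ʳ (τ ⟨$⟩ʳ (σ1 ⟨$⟩ˡ j))
    g≡σ2τσ1⁻¹ j = sym (trans (inverseʳ σ2) (cong (g ⟨$⟩ʳ_) (inverseʳ σ1)))
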